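{- Let $m\geq 1$ and $0\leq r\leq m$, and let $\mathcal{LRM}(r,m)\subseteq \mathbb{Z}_4^{2^{m-1}}$ be the quaternary code defined recursively below. Then $\mathcal{LRM}(r,m)$ is a quaternary linear code (an additive subgroup of $\mathbb{Z}_4^{2^{m-1}}$) of length $n=2^{m-1}$, with $2^k$ codewords where $k=\sum_{i=0}^{r}\binom{m}{i}$, and with minimum Lee distance $d=2^{m-r}$. Moreover, its image $\phi(\mathcal{LRM}(r,m))\subseteq\mathbb{Z}_2^{2^m}$ under the Gray map is a binary code with the parameters of the binary Reed–Muller code $RM(r,m)$ of order $r$, namely length $2^m$, $2^k$ codewords, and minimum Hamming distance $2^{m-r}$.
   Context: The Lee weight on $\mathbb{Z}_4$ is $w_L(0)=0$, $w_L(1)=w_L(3)=1$, $w_L(2)=2$, extended to $\mathbb{Z}_4^n$ by summing over coordinates; the Lee distance is $d_L(x,y)=w_L(x-y)$. The minimum (Lee) distance of a code is the minimum distance between two distinct codewords. Define maps $\beta,\gamma:\mathbb{Z}_4\to\mathbb{Z}_2$ by $\beta(0)=0,\beta(1)=0,\beta(2)=1,\beta(3)=1$ and $\gamma(0)=0,\gamma(1)=1,\gamma(2)=1,\gamma(3)=0$, extended coordinatewise; the Gray map $\phi:\mathbb{Z}_4^n\to\mathbb{Z}_2^{2n}$ is $\phi(x)=(\beta(x),\gamma(x))$. The binary Reed–Muller code $RM(r,m)$ has length $2^m$, $2^{k}$ codewords with $k=\sum_{i=0}^{r}\binom{m}{i}$, and minimum Hamming distance $2^{m-r}$. The codes $\mathcal{LRM}(r,m)$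 are defined as follows. For $m=1$: $\mathcal{LRM}(0,1)=\{(0),(2)\}\subseteq\mathbb{Z}_4$ and $\mathcal{LRM}(1,1)=\mathbb{Z}_4$. For $m\geq 2$ and $0\le r\le m$, by the Plotkin construction $$\mathcal{LRM}(r,m)=\{(x,x+y)\mid x\in\mathcal{LRM}(r,m-1),\ y\in\mathcal{LRM}(r-1,m-1)\},$$ with the conventions $\mathcal{LRM}(-1,m-1)=\{0\}$ (the zero vector of $\mathbb{Z}_4^{2^{m-2}}$) and $\mathcal{LRM}(m,m-1)=\mathbb{Z}_4^{2^{m-2}}$. -}

module Defs where

open import Data.Nat using (ℕ; zero; suc; _+_; _*_; _∸_; _^_; _≤_; _≤ᵇ_)
open import Data.Nat.Combinatorics using (_C_)
open import Data.Bool using (Bool; true; false; if_then_else_)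
import Data.Bool as B
open import Data.Vec using (Vec; []; _∷_; _++_; zipWith; replicate; foldr)
import Data.Vec as V
open import Data.Vec.Properties using (≡-dec)
open import Data.List using (List; []; _∷_; concatMap; deduplicate; length)
import Data.List as L
open import Data.List.Membership.Propositional using (_∈_)
open import Data.Product using (_×_; ∃-syntax; _,_)
open import Relation.Binary.PropositionalEquality using (_≡_; refl)
open import Relation.Binary.Definitions using (DecidableEquality)
open import Relation.Nullary using (¬_; yes; no)

data Z4 : Set where
  z0 z1 z2 z3 : Z4

_+4_ : Z4 → Z4 → Z4
z0 +4 b = b
z1 +4 z0 = z1
z1 +4 z1 = z2
z1 +4 z2 = z3
z1 +4 z3 = z0
z2 +4 z0 = z2
z2 +4 z1 = z3
z2 +4 z2 = z0
z2 +4 z3 = z1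
z3 +4 z0 = z3
z3 +4 z1 = z0
z3 +4 z2 = z1
z3 +4 z3 = z2

neg4 : Z4 → Z4
neg4 z0 = z0
neg4 z1 = z3
neg4 z2 = z2
neg4 z3 = z1

_−4_ : Z4 → Z4 → Z4
a −4 b = a +4 neg4 b

_≟4_ : DecidableEquality Z4
z0 ≟4 z0 = yes refl
z0 ≟4 z1 = no λ ()
z0 ≟4 z2 = no λ ()
z0 ≟4 z3 = no λ ()
z1 ≟4 z0 = no λ ()
z1 ≟4 z1 = yes refl
z1 ≟4 z2 = no λ ()
z1 ≟4 z3 = no λ ()
z2 ≟4 z0 = no λ ()
z2 ≟4 z1 = no λ ()
z2 ≟4 z2 = yes refl
z2 ≟4 z3 = no λ ()
z3 ≟4 z0 = no λ ()
z3 ≟4 z1 = no λ ()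
z3 ≟4 z2 = no λ ()
z3 ≟4 z3 = yes refl

_⊕_ : ∀ {n} → Vec Z4 n → Vec Z4 n → Vec Z4 n
_⊕_ = zipWith _+4_

⊖_ : ∀ {n} → Vec Z4 n → Vec Z4 n
⊖_ = V.map neg4

_⊝_ : ∀ {n} → Vec Z4 n → Vec Z4 n → Vec Z4 n
_⊝_ = zipWith _−4_

0ᵥ : ∀ {n} → Vec Z4 n
0ᵥ = replicate _ z0

_≟ᵥ_ : ∀ {n} → DecidableEquality (Vec Z4 n)
_≟ᵥ_ = ≡-dec _≟4_

allZ4 : List Z4
allZ4 = z0 ∷ z1 ∷ z2 ∷ z3 ∷ []

allVecs : (n : ℕ) → List (Vec Z4 n)
allVecs zero = [] ∷ []
allVecs (suc n) = concatMap (λ a → L.map (a ∷_) (allVecs n)) allZ4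

wL : Z4 → ℕ
wL z0 = 0
wL z1 = 1
wL z2 = 2
wL z3 = 1

leeWeight : ∀ {n} → Vec Z4 n → ℕ
leeWeight = foldr _ (λ a s → wL a + s) 0

leeDist : ∀ {n} → Vec Z4 n → Vec Z4 n → ℕ
leeDist x y = leeWeight (x ⊝ y)

hammingDist : ∀ {n} → Vec Bool n → Vec Bool n → ℕ
hammingDist x y = foldr _ (λ b s → (if b then 1 else 0) + s) 0 (zipWith B._xor_ x y)

-- Gray map  φ(x) = (β(x), γ(x)) ∈ ℤ₂^{2n}   (ℤ₂ = Bool)

β : Z4 → Bool
β z0 = false
β z1 = false
β z2 = true
β z3 = true

γ : Z4 → Bool
γ z0 = false
γ z1 = true
γ z2 = true
γ z3 = false

-- 2 * n unfolds to n + (n + 0)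
φ : ∀ {n} → Vec Z4 n → Vec Bool (2 * n)
φ x = V.map β x ++ (V.map γ x ++ [])

-- Codes are given by a (finite) list of codewords; the code is the set
-- of its members.

card : ∀ {A : Set} → DecidableEquality A → List A → ℕ
card _≟_ C = length (deduplicate _≟_ C)

IsAdditiveSubgroup : ∀ {n} → List (Vec Z4 n) → Set
IsAdditiveSubgroup C =
  (0ᵥ ∈ C) ×
  (∀ x y → x ∈ C → y ∈ C → (x ⊕ y) ∈ C) ×
  (∀ x → x ∈ C → (⊖ x) ∈ C)

MinDistance : ∀ {A : Set} → (A → A → ℕ) → List A → ℕ → Set
MinDistance {A} d C δ =
  (∃[ x ] ∃[ y ] (x ∈ C × y ∈ C × ¬ (x ≡ y) × d x y ≡ δ)) ×
  (∀ x y → x ∈ C → y ∈ C → ¬ (x ≡ y) → δ ≤ d x y)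

plotkin : ∀ {n} → List (Vec Z4 n) → List (Vec Z4 n) → List (Vec Z4 (2 * n))
plotkin xs ys = concatMap (λ x → L.map (λ y → x ++ ((x ⊕ y) ++ [])) ys) xs

-- LRM(r, m) ⊆ ℤ₄^{2^{m-1}}, for m ≥ 1.
-- Conventions: LRM(-1, m-1) = {0};  LRM(r, m) = ℤ₄^{2^{m-1}} for r > m
-- (only r = m+1 is ever used, matching LRM(m, m-1) = ℤ₄^{2^{m-2}}).
-- m = 0 is junk (empty list), never used.

LRM : ℕ → (m : ℕ) → List (Vec Z4 (2 ^ (m ∸ 1)))
LRM r zero = []
LRM zero (suc zero) = (z0 ∷ []) ∷ (z2 ∷ []) ∷ []
LRM (suc r) (suc zero) = allVecs 1
LRM zero (suc (suc m)) = plotkin (LRM zero (suc m)) (0ᵥ ∷ [])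
LRM (suc r) (suc (suc m)) =
  if suc r ≤ᵇ suc (suc m)
  then plotkin (LRM (suc r) (suc m)) (LRM r (suc m))
  else allVecs _

sumBinom : ℕ → ℕ → ℕ
sumBinom m zero = m C 0
sumBinom m (suc r) = sumBinom m r + m C (suc r)

-- LRM(r, m) arises from LRM(r, m-1) and LRM(r-1, m-1) by the Plotkin construction (u | u + v).
-- That construction preserves additive subgroups and multiplies the numbers of codewords, which
-- gives Pascal's rule for Σ_{i ≤ r} C(m, i). As wt(u | u + v) ≥ wt(v) by the triangle inequality
-- and wt(u | u) = 2 wt(u), its minimum Lee weight is min(2 d₁, d₂) = 2^(m-r). For an additive
-- code the minimum distance is the minimum weight, and the Gray map is an isometry from the Lee
-- to the Hamming distance, hence injective, so all parameters carry over to φ(LRM(r, m)).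
module Submission where

open import Defs
open import Data.Nat using (ℕ; _≤_; _∸_; _^_; _*_)
open import Data.Product using (_×_)
open import Data.List using (List; map)
open import Data.Bool using (Bool)
open import Data.Bool.Properties using (_≟_)
open import Data.Vec using (Vec)
open import Data.Vec.Properties using (≡-dec)
open import Relation.Binary.PropositionalEquality using (_≡_)

open import Level using (0ℓ)
open import Algebra.Bundles using (AbelianGroup)
open import Algebra.Core using (Op₁; Op₂)
open import Algebra.Structures {A = Z4} _≡_ using (IsAbelianGroup)
import Algebra.Structures as Structures
open import Algebra.Definitions {A = Z4} _≡_
  using (Associative; Commutative; RightIdentity; LeftInverse; RightInverse)
import Algebra.Properties.AbelianGroup as AbelianGroupProperties
import Algebra.Properties.CommutativeSemigroup as CommutativeSemigroupProperties
open import Data.Bool using (true; false; if_then_else_; _xor_)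
open import Data.Bool.Properties using (xor-same)
open import Data.List using ([]; _∷_; length; concatMap; cartesianProductWith; deduplicate)
import Data.List.Properties as List
open import Data.List.Membership.Propositional using (_∈_)
open import Data.List.Membership.Propositional.Properties
  using (∈-map⁺; ∈-map⁻; ∈-cartesianProductWith⁺; ∈-cartesianProductWith⁻)
open import Data.List.Relation.Unary.All using ([]; all?)
import Data.List.Relation.Unary.All as All
open import Data.List.Relation.Unary.Any using (here; there)
open import Data.List.Relation.Unary.Unique.Propositional using (Unique; []; _∷_)
import Data.List.Relation.Unary.Unique.Propositional.Properties as Unique
import Data.List.Relation.Unary.Unique.DecPropositional as DecUnique
open import Data.Nat using (zero; suc; _+_; _<_; _≤ᵇ_; z≤n; s≤s; s≤s⁻¹)
open import Data.Nat.Combinatorics using (_C_; nCk+nC[k+1]≡[n+1]C[k+1]; k>n⇒nCk≡0)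
open import Data.Nat.Properties
  using ( +-identityʳ; +-comm; +-mono-≤; ≤-refl; ≤-reflexive; ≤-trans; n<1+n; m≤n⇒m≤1+n
        ; m+n≡0⇒m≡0; m+n≡0⇒n≡0; n≢0⇒n>0; ≤⇒≤ᵇ; ≤ᵇ-reflects-≤; 1+n≰n; 0∸n≡0; m≤n⇒m∸n≡0; n≤1+n
        ; m≤n⇒m<n∨m≡n; m^n>0; ^-*-assoc; +-commutativeSemigroup; _≤?_ )
import Data.Nat.Properties as ℕ
open CommutativeSemigroupProperties +-commutativeSemigroup
  using () renaming (interchange to +-interchange)
open import Data.Product using (_,_; proj₁; proj₂; ∃-syntax)
open import Data.Vec using ([]; _∷_; _++_; zipWith; replicate)
import Data.Vec as Vec
import Data.Vec.Properties as Vec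
open import Data.Empty using (⊥-elim)
open import Data.Sum using (inj₁; inj₂)
open import Function using (_∘_)
open import Function.Definitions using (Injective)
open import Relation.Binary.Definitions using (DecidableEquality)
open import Relation.Binary.PropositionalEquality
  using (refl; sym; trans; cong; cong₂; subst; isEquivalence; _≢_; module ≡-Reasoning)
open import Relation.Nullary using (Dec; ¬?; yes; no)
open import Relation.Nullary.Decidable using (map′; from-yes)
open import Relation.Nullary.Reflects using (ofʸ)
open import Relation.Unary using (Decidable)

∈-allZ4 : ∀ a → a ∈ allZ4
∈-allZ4 z0 = here refl
∈-allZ4 z1 = there (here refl)
∈-allZ4 z2 = there (there (here refl))
∈-allZ4 z3 = there (there (there (here refl)))

∀-Z4? : {P : Z4 → Set} → Decidable P → Dec (∀ a → P a)
∀-Z4? P? = map′ (λ ps a → All.lookup ps (∈-allZ4 a)) (λ p → All.tabulate λ {a} _ → p a)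
                (all? P? allZ4)

+4-assoc : Associative _+4_
+4-assoc = from-yes (∀-Z4? λ a → ∀-Z4? λ b → ∀-Z4? λ c → ((a +4 b) +4 c) ≟4 (a +4 (b +4 c)))

+4-comm : Commutative _+4_
+4-comm = from-yes (∀-Z4? λ a → ∀-Z4? λ b → (a +4 b) ≟4 (b +4 a))

+4-identityʳ : RightIdentity z0 _+4_
+4-identityʳ = from-yes (∀-Z4? λ a → (a +4 z0) ≟4 a)

+4-inverseˡ : LeftInverse z0 neg4 _+4_
+4-inverseˡ = from-yes (∀-Z4? λ a → (neg4 a +4 a) ≟4 z0)

+4-inverseʳ : RightInverse z0 neg4 _+4_
+4-inverseʳ = from-yes (∀-Z4? λ a → (a +4 neg4 a) ≟4 z0)

wL-subadditive : ∀ a b → wL (a +4 b) ≤ wL a + wL b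
wL-subadditive = from-yes (∀-Z4? λ a → ∀-Z4? λ b → wL (a +4 b) ≤? (wL a + wL b))

wL-neg4 : ∀ a → wL (neg4 a) ≡ wL a
wL-neg4 = from-yes (∀-Z4? λ a → wL (neg4 a) ℕ.≟ wL a)

wL≡0⇒≡z0 : ∀ a → wL a ≡ 0 → a ≡ z0
wL≡0⇒≡z0 z0 _ = refl

indicator : Bool → ℕ
indicator b = if b then 1 else 0

βγ-isometry : ∀ a b → indicator (β a xor β b) + indicator (γ a xor γ b) ≡ wL (a −4 b)
βγ-isometry = from-yes (∀-Z4? λ a → ∀-Z4? λ b →
  (indicator (β a xor β b) + indicator (γ a xor γ b)) ℕ.≟ wL (a −4 b))

+4-isAbelianGroup : IsAbelianGroup _+4_ z0 neg4
+4-isAbelianGroup = record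
  { isGroup = record
    { isMonoid = record
      { isSemigroup = record
        { isMagma = record { isEquivalence = isEquivalence ; ∙-cong = cong₂ _+4_ }
        ; assoc = +4-assoc
        }
      ; identity = (λ _ → refl) , +4-identityʳ
      }
    ; inverse = +4-inverseˡ , +4-inverseʳ
    ; ⁻¹-cong = cong neg4
    }
  ; comm = +4-comm
  }

-- The group ℤ₄ⁿ, its Lee weight and the Gray map

zipWith-isAbelianGroup : ∀ {A : Set} {_∙_ : Op₂ A} {ε : A} {_⁻¹ : Op₁ A} →
  Structures.IsAbelianGroup _≡_ _∙_ ε _⁻¹ → ∀ n →
  Structures.IsAbelianGroup _≡_ (zipWith {n = n} _∙_) (replicate n ε) (Vec.map _⁻¹)
zipWith-isAbelianGroup {_∙_ = _∙_} {_⁻¹ = _⁻¹} G n = record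
  { isGroup = record
    { isMonoid = record
      { isSemigroup = record
        { isMagma = record { isEquivalence = isEquivalence ; ∙-cong = cong₂ (zipWith _∙_) }
        ; assoc = Vec.zipWith-assoc assoc
        }
      ; identity = Vec.zipWith-identityˡ identityˡ , Vec.zipWith-identityʳ identityʳ
      }
    ; inverse = Vec.zipWith-inverseˡ inverseˡ , Vec.zipWith-inverseʳ inverseʳ
    ; ⁻¹-cong = cong (Vec.map _⁻¹)
    }
  ; comm = Vec.zipWith-comm comm
  }
  where open Structures.IsAbelianGroup G using (assoc; identityˡ; identityʳ; inverseˡ; inverseʳ; comm)

ℤ₄^ : ℕ → AbelianGroup 0ℓ 0ℓ
ℤ₄^ n = record { isAbelianGroup = zipWith-isAbelianGroup +4-isAbelianGroup n }

module ℤ₄ⁿ {n : ℕ} where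
  open AbelianGroup (ℤ₄^ n) public using (identityˡ; identityʳ; commutativeSemigroup)
  open AbelianGroupProperties (ℤ₄^ n) public
    using (ε⁻¹≈ε; ⁻¹-∙-comm; ∙-cancelˡ; \\-leftDividesʳ; x∙y⁻¹≈ε⇒x≈y)
  open CommutativeSemigroupProperties commutativeSemigroup public using (interchange)

⊝≡⊕⊖ : ∀ {n} (x y : Vec Z4 n) → x ⊝ y ≡ x ⊕ (⊖ y)
⊝≡⊕⊖ x y = sym (Vec.zipWith-map₂ _+4_ neg4 x y)

⊝≡0ᵥ⇒≡ : ∀ {n} {x y : Vec Z4 n} → x ⊝ y ≡ 0ᵥ → x ≡ y
⊝≡0ᵥ⇒≡ {x = x} {y} eq = ℤ₄ⁿ.x∙y⁻¹≈ε⇒x≈y x y (trans (sym (⊝≡⊕⊖ x y)) eq)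

x⊝0ᵥ≡x : ∀ {n} (x : Vec Z4 n) → x ⊝ 0ᵥ ≡ x
x⊝0ᵥ≡x x = trans (⊝≡⊕⊖ x 0ᵥ) (trans (cong (x ⊕_) ℤ₄ⁿ.ε⁻¹≈ε) (ℤ₄ⁿ.identityʳ x))

replicate-++ : ∀ {A : Set} m {n} (a : A) → replicate (m + n) a ≡ replicate m a ++ replicate n a
replicate-++ zero    a = refl
replicate-++ (suc m) a = cong (a ∷_) (replicate-++ m a)

leeWeight-++ : ∀ {m n} (x : Vec Z4 m) (y : Vec Z4 n) →
  leeWeight (x ++ y) ≡ leeWeight x + leeWeight y
leeWeight-++ []      y = refl
leeWeight-++ (a ∷ x) y = trans (cong (wL a +_) (leeWeight-++ x y)) (sym (ℕ.+-assoc (wL a) _ _))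

leeWeight-0ᵥ : ∀ {n} → leeWeight (0ᵥ {n}) ≡ 0
leeWeight-0ᵥ {zero}  = refl
leeWeight-0ᵥ {suc n} = leeWeight-0ᵥ {n}

leeWeight≡0⇒≡0ᵥ : ∀ {n} (x : Vec Z4 n) → leeWeight x ≡ 0 → x ≡ 0ᵥ
leeWeight≡0⇒≡0ᵥ []      _  = refl
leeWeight≡0⇒≡0ᵥ (a ∷ x) eq =
  cong₂ _∷_ (wL≡0⇒≡z0 a (m+n≡0⇒m≡0 (wL a) eq)) (leeWeight≡0⇒≡0ᵥ x (m+n≡0⇒n≡0 (wL a) eq))

leeWeight-⊖ : ∀ {n} (x : Vec Z4 n) → leeWeight (⊖ x) ≡ leeWeight x
leeWeight-⊖ []      = refl
leeWeight-⊖ (a ∷ x) = cong₂ _+_ (wL-neg4 a) (leeWeight-⊖ x)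

leeWeight-⊕-≤ : ∀ {n} (x y : Vec Z4 n) → leeWeight (x ⊕ y) ≤ leeWeight x + leeWeight y
leeWeight-⊕-≤ []      []      = z≤n
leeWeight-⊕-≤ (a ∷ x) (b ∷ y) = ≤-trans (+-mono-≤ (wL-subadditive a b) (leeWeight-⊕-≤ x y))
  (≤-reflexive (+-interchange (wL a) (wL b) (leeWeight x) (leeWeight y)))

leeWeight-≤-⊕ : ∀ {n} (x y : Vec Z4 n) → leeWeight y ≤ leeWeight x + leeWeight (x ⊕ y)
leeWeight-≤-⊕ x y = begin
  leeWeight y                              ≡⟨ cong leeWeight (ℤ₄ⁿ.\\-leftDividesʳ x y) ⟨
  leeWeight ((⊖ x) ⊕ (x ⊕ y))              ≤⟨ leeWeight-⊕-≤ (⊖ x) (x ⊕ y) ⟩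
  leeWeight (⊖ x) + leeWeight (x ⊕ y)      ≡⟨ cong (_+ leeWeight (x ⊕ y)) (leeWeight-⊖ x) ⟩
  leeWeight x + leeWeight (x ⊕ y)          ∎
  where open ℕ.≤-Reasoning

nonzero⇒leeWeight≥1 : ∀ {n} (x : Vec Z4 n) → x ≢ 0ᵥ → 1 ≤ leeWeight x
nonzero⇒leeWeight≥1 x x≢0 = n≢0⇒n>0 (x≢0 ∘ leeWeight≡0⇒≡0ᵥ x)

hammingDist-++ : ∀ {m n} (u u′ : Vec Bool m) (v v′ : Vec Bool n) →
  hammingDist (u ++ v) (u′ ++ v′) ≡ hammingDist u u′ + hammingDist v v′
hammingDist-++ []      []        v v′ = refl
hammingDist-++ (a ∷ u) (a′ ∷ u′) v v′ =
  trans (cong (indicator (a xor a′) +_) (hammingDist-++ u u′ v v′))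
        (sym (ℕ.+-assoc (indicator (a xor a′)) (hammingDist u u′) (hammingDist v v′)))

hammingDist-self : ∀ {n} (u : Vec Bool n) → hammingDist u u ≡ 0
hammingDist-self []      = refl
hammingDist-self (a ∷ u) rewrite xor-same a = hammingDist-self u

hammingDist-βγ : ∀ {n} (x y : Vec Z4 n) →
  hammingDist (Vec.map β x) (Vec.map β y) + hammingDist (Vec.map γ x) (Vec.map γ y) ≡ leeDist x y
hammingDist-βγ []      []      = refl
hammingDist-βγ (a ∷ x) (b ∷ y) =
  trans (+-interchange (indicator (β a xor β b)) _ (indicator (γ a xor γ b)) _)
        (cong₂ _+_ (βγ-isometry a b) (hammingDist-βγ x y))

φ-isometry : ∀ {n} (x y : Vec Z4 n) → hammingDist (φ x) (φ y) ≡ leeDist x y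
φ-isometry x y = begin
  hammingDist (φ x) (φ y)
    ≡⟨ hammingDist-++ (Vec.map β x) (Vec.map β y) _ _ ⟩
  hammingDist (Vec.map β x) (Vec.map β y) + hammingDist (Vec.map γ x ++ []) (Vec.map γ y ++ [])
    ≡⟨ cong (hammingDist (Vec.map β x) (Vec.map β y) +_)
            (trans (hammingDist-++ (Vec.map γ x) (Vec.map γ y) [] []) (+-identityʳ _)) ⟩
  hammingDist (Vec.map β x) (Vec.map β y) + hammingDist (Vec.map γ x) (Vec.map γ y)
    ≡⟨ hammingDist-βγ x y ⟩
  leeDist x y ∎
  where open ≡-Reasoning

-- An isometry between definite distances is injective.
φ-injective : ∀ {n} → Injective _≡_ _≡_ (φ {n})
φ-injective {x = x} {y} φx≡φy = ⊝≡0ᵥ⇒≡ (leeWeight≡0⇒≡0ᵥ (x ⊝ y) leeDist≡0)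
  where
  leeDist≡0 : leeDist x y ≡ 0
  leeDist≡0 = trans (sym (φ-isometry x y))
                    (trans (cong (hammingDist (φ x)) (sym φx≡φy)) (hammingDist-self (φ x)))

card-unique : ∀ {A : Set} (_≟A_ : DecidableEquality A) {𝒞 : List A} → Unique 𝒞 → card _≟A_ 𝒞 ≡ length 𝒞
card-unique _≟A_ = cong length ∘ deduplicate-unique
  where
  deduplicate-unique : ∀ {𝒞} → Unique 𝒞 → deduplicate _≟A_ 𝒞 ≡ 𝒞
  deduplicate-unique []             = refl
  deduplicate-unique {x ∷ _} (x∉ ∷ 𝒞!) rewrite deduplicate-unique 𝒞! =
    cong (x ∷_) (List.filter-all (¬? ∘ (x ≟A_)) x∉)

NonzeroWeightsAtLeast : ∀ {n} → List (Vec Z4 n) → ℕ → Set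
NonzeroWeightsAtLeast 𝒞 d = ∀ x → x ∈ 𝒞 → x ≢ 0ᵥ → d ≤ leeWeight x

AttainsNonzeroWeight : ∀ {n} → List (Vec Z4 n) → ℕ → Set
AttainsNonzeroWeight 𝒞 d = ∃[ w ] w ∈ 𝒞 × w ≢ 0ᵥ × leeWeight w ≡ d

record MinWeight {n} (𝒞 : List (Vec Z4 n)) (d : ℕ) : Set where
  field
    lowerBound : NonzeroWeightsAtLeast 𝒞 d
    attained   : AttainsNonzeroWeight 𝒞 d

MinDistance-linear : ∀ {n} {𝒞 : List (Vec Z4 n)} {d} →
  IsAdditiveSubgroup 𝒞 → MinWeight 𝒞 d → MinDistance leeDist 𝒞 d
MinDistance-linear {𝒞 = 𝒞} (0∈𝒞 , ⊕-closed , ⊖-closed)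
                   record { lowerBound = bound ; attained = w , w∈𝒞 , w≢0 , ∣w∣≡d } =
  (w , 0ᵥ , w∈𝒞 , 0∈𝒞 , w≢0 , trans (cong leeWeight (x⊝0ᵥ≡x w)) ∣w∣≡d) ,
  λ x y x∈𝒞 y∈𝒞 x≢y → bound (x ⊝ y) (x⊝y∈𝒞 x y x∈𝒞 y∈𝒞) (x≢y ∘ ⊝≡0ᵥ⇒≡)
  where
  x⊝y∈𝒞 : ∀ x y → x ∈ 𝒞 → y ∈ 𝒞 → (x ⊝ y) ∈ 𝒞
  x⊝y∈𝒞 x y x∈𝒞 y∈𝒞 = subst (_∈ 𝒞) (sym (⊝≡⊕⊖ x y)) (⊕-closed x (⊖ y) x∈𝒞 (⊖-closed y y∈𝒞))

MinDistance-isometry : ∀ {A B : Set} {dA : A → A → ℕ} {dB : B → B → ℕ} (f : A → B) →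
  Injective _≡_ _≡_ f → (∀ x y → dB (f x) (f y) ≡ dA x y) →
  ∀ {𝒞 δ} → MinDistance dA 𝒞 δ → MinDistance dB (map f 𝒞) δ
MinDistance-isometry {dB = dB} f f-inj f-iso {𝒞} {δ} ((x , y , x∈𝒞 , y∈𝒞 , x≢y , dxy≡δ) , bound) =
  (f x , f y , ∈-map⁺ f x∈𝒞 , ∈-map⁺ f y∈𝒞 , x≢y ∘ f-inj , trans (f-iso x y) dxy≡δ) ,
  bound′
  where
  bound′ : ∀ u v → u ∈ map f 𝒞 → v ∈ map f 𝒞 → u ≢ v → δ ≤ dB u v
  bound′ u v u∈ v∈ u≢v with ∈-map⁻ f u∈ | ∈-map⁻ f v∈
  ... | x , x∈𝒞 , refl | y , y∈𝒞 , refl =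
    subst (_ ≤_) (sym (f-iso x y)) (bound x y x∈𝒞 y∈𝒞 (u≢v ∘ cong f))

-- The Plotkin construction (u | u + v)

concatMap-map≡cartesianProductWith : ∀ {A B D : Set} (f : A → B → D) xs ys →
  concatMap (λ x → map (f x) ys) xs ≡ cartesianProductWith f xs ys
concatMap-map≡cartesianProductWith f []       ys = refl
concatMap-map≡cartesianProductWith f (x ∷ xs) ys =
  cong (map (f x) ys Data.List.++_) (concatMap-map≡cartesianProductWith f xs ys)

length-cartesianProductWith : ∀ {A B D : Set} (f : A → B → D) xs ys →
  length (cartesianProductWith f xs ys) ≡ length xs * length ys
length-cartesianProductWith f []       ys = refl
length-cartesianProductWith f (x ∷ xs) ys = begin
  length (map (f x) ys Data.List.++ cartesianProductWith f xs ys)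
    ≡⟨ List.length-++ (map (f x) ys) ⟩
  length (map (f x) ys) + length (cartesianProductWith f xs ys)
    ≡⟨ cong₂ _+_ (List.length-map (f x) ys) (length-cartesianProductWith f xs ys) ⟩
  length ys + length xs * length ys ∎
  where open ≡-Reasoning

plotkinWord : ∀ {n} → Vec Z4 n → Vec Z4 n → Vec Z4 (2 * n)
plotkinWord x y = x ++ ((x ⊕ y) ++ [])

plotkin≡cartesianProductWith : ∀ {n} (𝒞₁ 𝒞₂ : List (Vec Z4 n)) →
  plotkin 𝒞₁ 𝒞₂ ≡ cartesianProductWith plotkinWord 𝒞₁ 𝒞₂
plotkin≡cartesianProductWith = concatMap-map≡cartesianProductWith plotkinWord

∈-plotkin⁺ : ∀ {n} {𝒞₁ 𝒞₂ : List (Vec Z4 n)} {x y} → x ∈ 𝒞₁ → y ∈ 𝒞₂ → plotkinWord x y ∈ plotkin 𝒞₁ 𝒞₂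
∈-plotkin⁺ {𝒞₁ = 𝒞₁} {𝒞₂} x∈ y∈ =
  subst (_ ∈_) (sym (plotkin≡cartesianProductWith 𝒞₁ 𝒞₂)) (∈-cartesianProductWith⁺ plotkinWord x∈ y∈)

∈-plotkin⁻ : ∀ {n} (𝒞₁ 𝒞₂ : List (Vec Z4 n)) {z} → z ∈ plotkin 𝒞₁ 𝒞₂ →
  ∃[ x ] ∃[ y ] x ∈ 𝒞₁ × y ∈ 𝒞₂ × z ≡ plotkinWord x y
∈-plotkin⁻ 𝒞₁ 𝒞₂ z∈ =
  ∈-cartesianProductWith⁻ plotkinWord 𝒞₁ 𝒞₂ (subst (_ ∈_) (plotkin≡cartesianProductWith 𝒞₁ 𝒞₂) z∈)

plotkinWord-0ᵥ : ∀ {n} → plotkinWord (0ᵥ {n}) 0ᵥ ≡ 0ᵥ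
plotkinWord-0ᵥ {n} = begin
  plotkinWord o o      ≡⟨ cong (λ z → o ++ (z ++ [])) (ℤ₄ⁿ.identityˡ o) ⟩
  o ++ (o ++ [])       ≡⟨ cong (o ++_) (replicate-++ n {0} z0) ⟨
  o ++ 0ᵥ {n + 0}      ≡⟨ replicate-++ n {n + 0} z0 ⟨
  0ᵥ                   ∎
  where
  open ≡-Reasoning
  o = 0ᵥ {n}

plotkinWord-⊕ : ∀ {n} (x y x′ y′ : Vec Z4 n) →
  plotkinWord x y ⊕ plotkinWord x′ y′ ≡ plotkinWord (x ⊕ x′) (y ⊕ y′)
plotkinWord-⊕ x y x′ y′ = begin
  (x ++ ((x ⊕ y) ++ [])) ⊕ (x′ ++ ((x′ ⊕ y′) ++ []))
    ≡⟨ Vec.zipWith-++ _+4_ x _ x′ _ ⟩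
  (x ⊕ x′) ++ (((x ⊕ y) ++ []) ⊕ ((x′ ⊕ y′) ++ []))
    ≡⟨ cong ((x ⊕ x′) ++_) (Vec.zipWith-++ _+4_ (x ⊕ y) [] (x′ ⊕ y′) []) ⟩
  (x ⊕ x′) ++ (((x ⊕ y) ⊕ (x′ ⊕ y′)) ++ [])
    ≡⟨ cong (λ z → (x ⊕ x′) ++ (z ++ [])) (ℤ₄ⁿ.interchange x y x′ y′) ⟩
  (x ⊕ x′) ++ (((x ⊕ x′) ⊕ (y ⊕ y′)) ++ []) ∎
  where open ≡-Reasoning

plotkinWord-⊖ : ∀ {n} (x y : Vec Z4 n) → ⊖ plotkinWord x y ≡ plotkinWord (⊖ x) (⊖ y)
plotkinWord-⊖ x y = begin
  ⊖ (x ++ ((x ⊕ y) ++ []))          ≡⟨ Vec.map-++ neg4 x _ ⟩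
  (⊖ x) ++ ⊖ ((x ⊕ y) ++ [])        ≡⟨ cong ((⊖ x) ++_) (Vec.map-++ neg4 (x ⊕ y) []) ⟩
  (⊖ x) ++ ((⊖ (x ⊕ y)) ++ [])      ≡⟨ cong (λ z → (⊖ x) ++ (z ++ [])) (ℤ₄ⁿ.⁻¹-∙-comm x y) ⟨
  (⊖ x) ++ (((⊖ x) ⊕ (⊖ y)) ++ [])  ∎
  where open ≡-Reasoning

plotkinWord-injective : ∀ {n} {x x′ y y′ : Vec Z4 n} →
  plotkinWord x y ≡ plotkinWord x′ y′ → x ≡ x′ × y ≡ y′
plotkinWord-injective {x = x} {x′} {y} {y′} eq with Vec.++-injective x x′ eq
... | refl , x⊕y++[]≡x⊕y′++[] =
  refl , ℤ₄ⁿ.∙-cancelˡ x y y′ (Vec.++-injectiveˡ (x ⊕ y) (x ⊕ y′) x⊕y++[]≡x⊕y′++[])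

plotkinWord≡0ᵥ⇒ : ∀ {n} (x y : Vec Z4 n) → plotkinWord x y ≡ 0ᵥ → x ≡ 0ᵥ × y ≡ 0ᵥ
plotkinWord≡0ᵥ⇒ {n} _ _ eq = plotkinWord-injective (trans eq (sym (plotkinWord-0ᵥ {n})))

leeWeight-plotkinWord : ∀ {n} (x y : Vec Z4 n) →
  leeWeight (plotkinWord x y) ≡ leeWeight x + leeWeight (x ⊕ y)
leeWeight-plotkinWord x y =
  trans (leeWeight-++ x _) (cong (leeWeight x +_) (trans (leeWeight-++ (x ⊕ y) []) (+-identityʳ _)))

leeWeight-plotkinWord-0ᵥˡ : ∀ {n} (y : Vec Z4 n) → leeWeight (plotkinWord 0ᵥ y) ≡ leeWeight y
leeWeight-plotkinWord-0ᵥˡ {n} y =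
  trans (leeWeight-plotkinWord 0ᵥ y) (cong₂ _+_ (leeWeight-0ᵥ {n}) (cong leeWeight (ℤ₄ⁿ.identityˡ y)))

leeWeight-plotkinWord-0ᵥʳ : ∀ {n} (x : Vec Z4 n) → leeWeight (plotkinWord x 0ᵥ) ≡ 2 * leeWeight x
leeWeight-plotkinWord-0ᵥʳ x = begin
  leeWeight (plotkinWord x 0ᵥ)        ≡⟨ leeWeight-plotkinWord x 0ᵥ ⟩
  leeWeight x + leeWeight (x ⊕ 0ᵥ)    ≡⟨ cong (λ v → leeWeight x + leeWeight v) (ℤ₄ⁿ.identityʳ x) ⟩
  leeWeight x + leeWeight x           ≡⟨ cong (leeWeight x +_) (+-identityʳ (leeWeight x)) ⟨
  2 * leeWeight x                     ∎
  where open ≡-Reasoning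

plotkin-isAdditiveSubgroup : ∀ {n} {𝒞₁ 𝒞₂ : List (Vec Z4 n)} →
  IsAdditiveSubgroup 𝒞₁ → IsAdditiveSubgroup 𝒞₂ → IsAdditiveSubgroup (plotkin 𝒞₁ 𝒞₂)
plotkin-isAdditiveSubgroup {n} {𝒞₁} {𝒞₂} (0∈₁ , ⊕-closed₁ , ⊖-closed₁) (0∈₂ , ⊕-closed₂ , ⊖-closed₂) =
  subst (_∈ plotkin 𝒞₁ 𝒞₂) (plotkinWord-0ᵥ {n}) (∈-plotkin⁺ 0∈₁ 0∈₂) , ⊕-closed , ⊖-closed
  where
  ⊕-closed : ∀ u v → u ∈ plotkin 𝒞₁ 𝒞₂ → v ∈ plotkin 𝒞₁ 𝒞₂ → (u ⊕ v) ∈ plotkin 𝒞₁ 𝒞₂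
  ⊕-closed u v u∈ v∈ with ∈-plotkin⁻ 𝒞₁ 𝒞₂ u∈ | ∈-plotkin⁻ 𝒞₁ 𝒞₂ v∈
  ... | x , y , x∈ , y∈ , refl | x′ , y′ , x′∈ , y′∈ , refl =
    subst (_∈ plotkin 𝒞₁ 𝒞₂) (sym (plotkinWord-⊕ x y x′ y′))
          (∈-plotkin⁺ (⊕-closed₁ x x′ x∈ x′∈) (⊕-closed₂ y y′ y∈ y′∈))
  ⊖-closed : ∀ u → u ∈ plotkin 𝒞₁ 𝒞₂ → (⊖ u) ∈ plotkin 𝒞₁ 𝒞₂
  ⊖-closed u u∈ with ∈-plotkin⁻ 𝒞₁ 𝒞₂ u∈
  ... | x , y , x∈ , y∈ , refl =
    subst (_∈ plotkin 𝒞₁ 𝒞₂) (sym (plotkinWord-⊖ x y)) (∈-plotkin⁺ (⊖-closed₁ x x∈) (⊖-closed₂ y y∈))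

plotkin-unique : ∀ {n} {𝒞₁ 𝒞₂ : List (Vec Z4 n)} → Unique 𝒞₁ → Unique 𝒞₂ → Unique (plotkin 𝒞₁ 𝒞₂)
plotkin-unique {𝒞₁ = 𝒞₁} {𝒞₂} 𝒞₁! 𝒞₂! = subst Unique (sym (plotkin≡cartesianProductWith 𝒞₁ 𝒞₂))
  (Unique.cartesianProductWith⁺ plotkinWord plotkinWord-injective 𝒞₁! 𝒞₂!)

length-plotkin : ∀ {n} (𝒞₁ 𝒞₂ : List (Vec Z4 n)) → length (plotkin 𝒞₁ 𝒞₂) ≡ length 𝒞₁ * length 𝒞₂
length-plotkin 𝒞₁ 𝒞₂ = trans (cong length (plotkin≡cartesianProductWith 𝒞₁ 𝒞₂))
                              (length-cartesianProductWith plotkinWord 𝒞₁ 𝒞₂)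

plotkin-nonzeroWeightsAtLeast : ∀ {n} {𝒞₁ 𝒞₂ : List (Vec Z4 n)} {d₁ d₂ d} →
  NonzeroWeightsAtLeast 𝒞₁ d₁ → NonzeroWeightsAtLeast 𝒞₂ d₂ → d ≤ 2 * d₁ → d ≤ d₂ →
  NonzeroWeightsAtLeast (plotkin 𝒞₁ 𝒞₂) d
plotkin-nonzeroWeightsAtLeast {n} {𝒞₁} {𝒞₂} {d₁} {d₂} {d} bound₁ bound₂ d≤2d₁ d≤d₂ z z∈ z≢0
  with ∈-plotkin⁻ 𝒞₁ 𝒞₂ z∈
... | x , y , x∈ , y∈ , refl with y ≟ᵥ 0ᵥ
...   | yes refl = begin
  d                              ≤⟨ d≤2d₁ ⟩
  2 * d₁                         ≤⟨ ℕ.*-monoʳ-≤ 2 (bound₁ x x∈ λ { refl → z≢0 (plotkinWord-0ᵥ {n}) }) ⟩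
  2 * leeWeight x                ≡⟨ leeWeight-plotkinWord-0ᵥʳ x ⟨
  leeWeight (plotkinWord x 0ᵥ)   ∎
  where open ℕ.≤-Reasoning
...   | no y≢0 = begin
  d                                 ≤⟨ d≤d₂ ⟩
  d₂                                ≤⟨ bound₂ y y∈ y≢0 ⟩
  leeWeight y                       ≤⟨ leeWeight-≤-⊕ x y ⟩
  leeWeight x + leeWeight (x ⊕ y)   ≡⟨ leeWeight-plotkinWord x y ⟨
  leeWeight (plotkinWord x y)       ∎
  where open ℕ.≤-Reasoning

plotkin-attainsNonzeroWeightʳ : ∀ {n} {𝒞₁ 𝒞₂ : List (Vec Z4 n)} {d} →
  0ᵥ ∈ 𝒞₁ → AttainsNonzeroWeight 𝒞₂ d → AttainsNonzeroWeight (plotkin 𝒞₁ 𝒞₂) d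
plotkin-attainsNonzeroWeightʳ 0∈𝒞₁ (y , y∈ , y≢0 , ∣y∣≡d) =
  plotkinWord 0ᵥ y , ∈-plotkin⁺ 0∈𝒞₁ y∈ , y≢0 ∘ proj₂ ∘ plotkinWord≡0ᵥ⇒ 0ᵥ y ,
  trans (leeWeight-plotkinWord-0ᵥˡ y) ∣y∣≡d

plotkin-attainsNonzeroWeightˡ : ∀ {n} {𝒞₁ 𝒞₂ : List (Vec Z4 n)} {d} →
  AttainsNonzeroWeight 𝒞₁ d → 0ᵥ ∈ 𝒞₂ → AttainsNonzeroWeight (plotkin 𝒞₁ 𝒞₂) (2 * d)
plotkin-attainsNonzeroWeightˡ (x , x∈ , x≢0 , ∣x∣≡d) 0∈𝒞₂ =
  plotkinWord x 0ᵥ , ∈-plotkin⁺ x∈ 0∈𝒞₂ , x≢0 ∘ proj₁ ∘ plotkinWord≡0ᵥ⇒ x 0ᵥ ,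
  trans (leeWeight-plotkinWord-0ᵥʳ x) (cong (2 *_) ∣x∣≡d)

record IsLinearCode {n} (𝒞 : List (Vec Z4 n)) (k d : ℕ) : Set where
  field
    isAdditiveSubgroup : IsAdditiveSubgroup 𝒞
    unique             : Unique 𝒞
    length≡2^k         : length 𝒞 ≡ 2 ^ k
    minWeight          : MinWeight 𝒞 d

  0ᵥ∈ : 0ᵥ ∈ 𝒞
  0ᵥ∈ = proj₁ isAdditiveSubgroup

  open MinWeight minWeight public

plotkin-isLinearCode : ∀ {n} {𝒞₁ 𝒞₂ : List (Vec Z4 n)} {k₁ k₂ d₁ d₂} →
  IsLinearCode 𝒞₁ k₁ d₁ → IsLinearCode 𝒞₂ k₂ d₂ → d₂ ≤ 2 * d₁ →
  IsLinearCode (plotkin 𝒞₁ 𝒞₂) (k₁ + k₂) d₂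
plotkin-isLinearCode {𝒞₁ = 𝒞₁} {𝒞₂} {k₁} {k₂} 𝒞₁-code 𝒞₂-code d₂≤2d₁ = record
  { isAdditiveSubgroup = plotkin-isAdditiveSubgroup L₁.isAdditiveSubgroup L₂.isAdditiveSubgroup
  ; unique             = plotkin-unique L₁.unique L₂.unique
  ; length≡2^k         = begin
      length (plotkin 𝒞₁ 𝒞₂)      ≡⟨ length-plotkin 𝒞₁ 𝒞₂ ⟩
      length 𝒞₁ * length 𝒞₂      ≡⟨ cong₂ _*_ L₁.length≡2^k L₂.length≡2^k ⟩
      2 ^ k₁ * 2 ^ k₂             ≡⟨ ℕ.^-distribˡ-+-* 2 k₁ k₂ ⟨
      2 ^ (k₁ + k₂)               ∎
  ; minWeight          = record
    { lowerBound = plotkin-nonzeroWeightsAtLeast L₁.lowerBound L₂.lowerBound d₂≤2d₁ ≤-refl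
    ; attained   = plotkin-attainsNonzeroWeightʳ L₁.0ᵥ∈ L₂.attained
    }
  }
  where
  open ≡-Reasoning
  module L₁ = IsLinearCode 𝒞₁-code
  module L₂ = IsLinearCode 𝒞₂-code

zero-isAdditiveSubgroup : ∀ {n} → IsAdditiveSubgroup (0ᵥ {n} ∷ [])
zero-isAdditiveSubgroup =
  here refl ,
  (λ { _ _ (here refl) (here refl) → here (ℤ₄ⁿ.identityˡ 0ᵥ) }) ,
  (λ { _ (here refl) → here ℤ₄ⁿ.ε⁻¹≈ε })

zero-nonzeroWeightsAtLeast : ∀ {n} d → NonzeroWeightsAtLeast (0ᵥ {n} ∷ []) d
zero-nonzeroWeightsAtLeast d _ (here refl) 0≢0 = ⊥-elim (0≢0 refl)

plotkin-zero-isLinearCode : ∀ {n} {𝒞 : List (Vec Z4 n)} {k d} →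
  IsLinearCode 𝒞 k d → IsLinearCode (plotkin 𝒞 (0ᵥ ∷ [])) k (2 * d)
plotkin-zero-isLinearCode {𝒞 = 𝒞} {d = d} 𝒞-code = record
  { isAdditiveSubgroup = plotkin-isAdditiveSubgroup L.isAdditiveSubgroup zero-isAdditiveSubgroup
  ; unique             = plotkin-unique L.unique ([] ∷ [])
  ; length≡2^k         = trans (length-plotkin 𝒞 (0ᵥ ∷ [])) (trans (ℕ.*-identityʳ _) L.length≡2^k)
  ; minWeight          = record
    { lowerBound = plotkin-nonzeroWeightsAtLeast L.lowerBound (zero-nonzeroWeightsAtLeast (2 * d))
                                                 ≤-refl ≤-refl
    ; attained   = plotkin-attainsNonzeroWeightˡ L.attained (here refl)
    }
  }
  where module L = IsLinearCode 𝒞-code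

-- The codes LRM(r, m)

allVecs-suc : ∀ n → allVecs (suc n) ≡ cartesianProductWith _∷_ allZ4 (allVecs n)
allVecs-suc n = concatMap-map≡cartesianProductWith _∷_ allZ4 (allVecs n)

∈-allVecs : ∀ {n} (x : Vec Z4 n) → x ∈ allVecs n
∈-allVecs []          = here refl
∈-allVecs {suc n} (a ∷ x) =
  subst ((a ∷ x) ∈_) (sym (allVecs-suc n)) (∈-cartesianProductWith⁺ _∷_ (∈-allZ4 a) (∈-allVecs x))

allVecs-unique : ∀ n → Unique (allVecs n)
allVecs-unique zero    = [] ∷ []
allVecs-unique (suc n) = subst Unique (sym (allVecs-suc n))
  (Unique.cartesianProductWith⁺ _∷_ Vec.∷-injective allZ4-unique (allVecs-unique n))
  where
  allZ4-unique : Unique allZ4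
  allZ4-unique = from-yes (DecUnique.unique? _≟4_ allZ4)

length-allVecs : ∀ n → length (allVecs n) ≡ 2 ^ (2 * n)
length-allVecs n = trans (length-allVecs′ n) (^-*-assoc 2 2 n)
  where
  length-allVecs′ : ∀ n → length (allVecs n) ≡ 4 ^ n
  length-allVecs′ zero    = refl
  length-allVecs′ (suc n) = begin
    length (allVecs (suc n))                              ≡⟨ cong length (allVecs-suc n) ⟩
    length (cartesianProductWith _∷_ allZ4 (allVecs n))
      ≡⟨ length-cartesianProductWith _∷_ allZ4 (allVecs n) ⟩
    4 * length (allVecs n)                                ≡⟨ cong (4 *_) (length-allVecs′ n) ⟩
    4 ^ suc n                                             ∎
    where open ≡-Reasoning

allVecs-isLinearCode : ∀ n → 0 < n → IsLinearCode (allVecs n) (2 * n) 1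
allVecs-isLinearCode (suc n) _ = record
  { isAdditiveSubgroup = ∈-allVecs 0ᵥ , (λ x y _ _ → ∈-allVecs (x ⊕ y)) , (λ x _ → ∈-allVecs (⊖ x))
  ; unique             = allVecs-unique (suc n)
  ; length≡2^k         = length-allVecs (suc n)
  ; minWeight = record
    { lowerBound = λ x _ → nonzero⇒leeWeight≥1 x
    ; attained   = z1 ∷ 0ᵥ , ∈-allVecs (z1 ∷ 0ᵥ) , (λ ()) , cong suc (leeWeight-0ᵥ {n})
    }
  }

sumBinom-pascal : ∀ m r → sumBinom (suc m) (suc r) ≡ sumBinom m (suc r) + sumBinom m r
sumBinom-pascal m zero = begin
  1 + suc m C 1          ≡⟨ cong (1 +_) (nCk+nC[k+1]≡[n+1]C[k+1] m 0) ⟨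
  1 + (1 + m C 1)        ≡⟨ cong suc (+-comm 1 (m C 1)) ⟩
  (1 + m C 1) + 1        ∎
  where open ≡-Reasoning
sumBinom-pascal m (suc r) = begin
  sumBinom (suc m) (suc r) + suc m C suc (suc r)
    ≡⟨ cong₂ _+_ (sumBinom-pascal m r) (sym (nCk+nC[k+1]≡[n+1]C[k+1] m (suc r))) ⟩
  (sumBinom m (suc r) + sumBinom m r) + (m C suc r + m C suc (suc r))
    ≡⟨ cong (sumBinom m (suc r) + sumBinom m r +_) (+-comm (m C suc r) _) ⟩
  (sumBinom m (suc r) + sumBinom m r) + (m C suc (suc r) + m C suc r)
    ≡⟨ +-interchange (sumBinom m (suc r)) _ _ _ ⟩
  sumBinom m (suc (suc r)) + sumBinom m (suc r) ∎
  where open ≡-Reasoning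

sumBinom-beyond : ∀ m → sumBinom m (suc m) ≡ 2 ^ m
sumBinom-beyond zero    = refl
sumBinom-beyond (suc m) = begin
  sumBinom (suc m) (suc (suc m))              ≡⟨ sumBinom-pascal m (suc m) ⟩
  sumBinom m (suc (suc m)) + sumBinom m (suc m)
    ≡⟨ cong (λ c → (sumBinom m (suc m) + c) + sumBinom m (suc m)) (k>n⇒nCk≡0 (m≤n⇒m≤1+n (n<1+n m))) ⟩
  (sumBinom m (suc m) + 0) + sumBinom m (suc m)
    ≡⟨ cong₂ _+_ (trans (+-identityʳ _) (sumBinom-beyond m))
                 (trans (sumBinom-beyond m) (sym (+-identityʳ _))) ⟩
  2 ^ suc m                                   ∎
  where open ≡-Reasoning

LRM-plotkin : ∀ {m r} → r ≤ suc m →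
  LRM (suc r) (suc (suc m)) ≡ plotkin (LRM (suc r) (suc m)) (LRM r (suc m))
LRM-plotkin {m} {r} r≤1+m with suc r ≤ᵇ suc (suc m) | ≤⇒≤ᵇ (s≤s r≤1+m)
... | true | _ = refl

LRM-full : ∀ m → LRM (suc (suc (suc m))) (suc (suc m)) ≡ allVecs (2 ^ suc m)
LRM-full m with suc (suc (suc m)) ≤ᵇ suc (suc m) | ≤ᵇ-reflects-≤ (suc (suc (suc m))) (suc (suc m))
... | false | _               = refl
... | true  | ofʸ 3+m≤2+m = ⊥-elim (1+n≰n 3+m≤2+m)

suc-∸-≤ : ∀ m n → suc m ∸ n ≤ suc (m ∸ n)
suc-∸-≤ m       zero    = ≤-refl
suc-∸-≤ zero    (suc n) = ≤-trans (≤-reflexive (0∸n≡0 n)) z≤n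
suc-∸-≤ (suc m) (suc n) = suc-∸-≤ m n

LRM-0-1-isLinearCode : IsLinearCode (LRM 0 1) 1 2
LRM-0-1-isLinearCode = record
  { isAdditiveSubgroup = here refl , ⊕-closed , ⊖-closed
  ; unique             = from-yes (DecUnique.unique? _≟ᵥ_ (LRM 0 1))
  ; length≡2^k         = refl
  ; minWeight = record
    { lowerBound = λ { _ (here refl) 0≢0 → ⊥-elim (0≢0 refl) ; _ (there (here refl)) _ → ≤-refl }
    ; attained   = z2 ∷ [] , there (here refl) , (λ ()) , refl
    }
  }
  where
  ⊕-closed : ∀ x y → x ∈ LRM 0 1 → y ∈ LRM 0 1 → (x ⊕ y) ∈ LRM 0 1
  ⊕-closed _ _ (here refl)         (here refl)         = here refl
  ⊕-closed _ _ (here refl)         (there (here refl)) = there (here refl)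
  ⊕-closed _ _ (there (here refl)) (here refl)         = there (here refl)
  ⊕-closed _ _ (there (here refl)) (there (here refl)) = here refl
  ⊖-closed : ∀ x → x ∈ LRM 0 1 → (⊖ x) ∈ LRM 0 1
  ⊖-closed _ (here refl)         = here refl
  ⊖-closed _ (there (here refl)) = there (here refl)

LRM-isLinearCode : ∀ m r → r ≤ suc (suc m) →
  IsLinearCode (LRM r (suc m)) (sumBinom (suc m) r) (2 ^ (suc m ∸ r))
LRM-isLinearCode zero zero _ = LRM-0-1-isLinearCode
LRM-isLinearCode zero (suc zero)       _ = allVecs-isLinearCode 1 (s≤s z≤n)
LRM-isLinearCode zero (suc (suc zero)) _ = allVecs-isLinearCode 1 (s≤s z≤n)
LRM-isLinearCode zero (suc (suc (suc _))) (s≤s (s≤s ()))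
LRM-isLinearCode (suc m) zero _ = plotkin-zero-isLinearCode (LRM-isLinearCode m zero z≤n)
LRM-isLinearCode (suc m) (suc r) 1+r≤3+m with m≤n⇒m<n∨m≡n (s≤s⁻¹ 1+r≤3+m)
... | inj₁ (s≤s r≤1+m) rewrite LRM-plotkin r≤1+m | sumBinom-pascal (suc m) r =
  plotkin-isLinearCode (LRM-isLinearCode m (suc r) (s≤s r≤1+m)) (LRM-isLinearCode m r (m≤n⇒m≤1+n r≤1+m))
                       (ℕ.^-monoʳ-≤ 2 (suc-∸-≤ m r))
... | inj₂ refl rewrite LRM-full m | sumBinom-beyond (suc (suc m)) | m≤n⇒m∸n≡0 (n≤1+n m) =
  allVecs-isLinearCode (2 ^ suc m) (m^n>0 2 (suc m))

theorem1 : (m r : ℕ) → 1 ≤ m → r ≤ m →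
    IsAdditiveSubgroup (LRM r m) ×
    card _≟ᵥ_ (LRM r m) ≡ 2 ^ sumBinom m r ×
    MinDistance leeDist (LRM r m) (2 ^ (m ∸ r)) ×
    2 * 2 ^ (m ∸ 1) ≡ 2 ^ m ×
    card (≡-dec _≟_) (map φ (LRM r m)) ≡ 2 ^ sumBinom m r ×
    MinDistance hammingDist (map φ (LRM r m)) (2 ^ (m ∸ r))
theorem1 (suc m) r _ r≤1+m =
  isAdditiveSubgroup ,
  trans (card-unique _≟ᵥ_ unique) length≡2^k ,
  leeMinDistance ,
  refl ,
  trans (card-unique (≡-dec _≟_) (Unique.map⁺ φ-injective unique))
        (trans (List.length-map φ (LRM r (suc m))) length≡2^k) ,
  MinDistance-isometry φ φ-injective φ-isometry leeMinDistance
  where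
  open IsLinearCode (LRM-isLinearCode m r (m≤n⇒m≤1+n r≤1+m))
  leeMinDistance : MinDistance leeDist (LRM r (suc m)) (2 ^ (suc m ∸ r))
  leeMinDistance = MinDistance-linear isAdditiveSubgroup minWeight
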